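{- Let $\mathcal C$ be an indecomposable coherent configuration on more than $2$ points all of whose fibers have size $4$ or $2$. Suppose that no interspace of $\mathcal C$ contains a matching basis relation. Let $X$ be a fiber of $\mathcal C$ with $|X|=2$. Then $\mathcal C$ is separable if and only if $\mathcal C\setminus X$ is separable.
   Context: A coherent configuration on a finite set $V$ is a partition $\mathcal C$ of $V\times V$ into basis relations such that: (A) a basis relation containing a loop consists of loops; (B) the transpose of a basis relation is a basis relation; (C) for all $R,S,T\in\mathcal C$ the number $|\{w:uw\in R,wv\in S\}|$ is the same for all $uv\in T$, denoted $p^T_{RS}$. Fibers are sets $X$ with $\{xx:x\in X\}\in\mathcal C$. For distinct fibers $X,Y$, the interspace $\mathcal C[X,Y]$ is the set of basis relations contained in $X\times Y$; it is uniform if it equals $\{X\times Y\}$. A basis relation $M\in\mathcal C[X,Y]$ is a matching if each $x\in X$ has exactly one $y$ with $xy\in M$ and vice versa. $\mathcal C$ is indecomposable if there is no partition of the set of fibers into two nonempty parts such that every interspace between a fiber of one part and a fiber of the other part is uniform. $\mathcal C\setminus X$ is the coherent configuration formed by the basis relations contained in $(V\setminus X)^2$. Separable: every algebraic isomorphism (bijection $f:\mathcal C\to\mathcal C'$ onto a coherent configuration with $p^T_{RS}=p^{f(T)}_{f(R)f(S)}$) is induced by a combinatorial isomorphism (bijection $\phi$ of point sets with $\phi(R)=f(R)$ for all $R\in\mathcal C$). -}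

module Defs where

open import Data.Nat using (ℕ; _>_)
open import Data.Fin using (Fin; _≟_)
open import Data.List using (length; filter; allFin)
open import Data.Product using (Σ; ∃; _×_; _,_)
open import Data.Sum using (_⊎_)
open import Data.Bool using (Bool)
open import Relation.Nullary using (¬_)
open import Relation.Nullary.Decidable using (_×-dec_)
open import Relation.Unary using (Pred; Decidable)
open import Relation.Binary.PropositionalEquality using (_≡_; _≢_)
open import Function.Bundles using (Bijection; _⤖_; _⇔_)
open import Level using (0ℓ)

number : ∀ {n} {P : Pred (Fin n) 0ℓ} → Decidable P → ℕ
number {n} P? = length (filter P? (allFin n))

-- A coherent configuration on the point set Fin n with r basis relations,
-- given by a colouring: the basis relation with index i is the set of pairs
-- uv with col u v ≡ i.
-- p col u v R S = |{w : uw ∈ R, wv ∈ S}|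
p : ∀ {n r} → (Fin n → Fin n → Fin r) → Fin n → Fin n → Fin r → Fin r → ℕ
p col u v R S = number (λ w → (col u w ≟ R) ×-dec (col w v ≟ S))

record CC (n r : ℕ) : Set where
  field
    col : Fin n → Fin n → Fin r
    nonempty : ∀ i → ∃ λ u → ∃ λ v → col u v ≡ i
    loops : ∀ x u v → col u v ≡ col x x → u ≡ v
    transp : ∀ u v u' v' → col u v ≡ col u' v' → col v u ≡ col v' u'
    coh : ∀ R S u v u' v' → col u v ≡ col u' v' → p col u v R S ≡ p col u' v' R S

open CC public

record AlgIso {n r n' r'} (C : CC n r) (C' : CC n' r') : Set where
  field
    f : Fin r ⤖ Fin r'
    pres : ∀ R S u v u' v' →
           col C' u' v' ≡ Bijection.to f (col C u v) →
           p (col C) u v R S ≡ p (col C') u' v' (Bijection.to f R) (Bijection.to f S)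

open AlgIso public

Induced : ∀ {n r n' r'} {C : CC n r} {C' : CC n' r'} → AlgIso C C' → Set
Induced {n} {r} {n'} {r'} {C} {C'} a =
  Σ (Fin n ⤖ Fin n') λ φ → ∀ u v →
    col C' (Bijection.to φ u) (Bijection.to φ v) ≡ Bijection.to (f a) (col C u v)

Separable : ∀ {n r} → CC n r → Set
Separable {n} {r} C = ∀ n' r' (C' : CC n' r') (a : AlgIso C C') → Induced a

-- x and y lie in the same fiber (fibers ↔ loop basis relations)
SameFiber : ∀ {n r} → CC n r → Fin n → Fin n → Set
SameFiber C x y = col C x x ≡ col C y y

fiberSize : ∀ {n r} → CC n r → Fin n → ℕ
fiberSize C x = number (λ y → col C y y ≟ col C x x)

IsMatching : ∀ {n r} → CC n r → Fin n → Fin n → Set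
IsMatching C u v =
  (∀ x → SameFiber C x u → number (λ y → col C x y ≟ col C u v) ≡ 1) ×
  (∀ y → SameFiber C y v → number (λ x → col C x y ≟ col C u v) ≡ 1)

NoMatchingInterspace : ∀ {n r} → CC n r → Set
NoMatchingInterspace C = ∀ u v → ¬ SameFiber C u v → ¬ IsMatching C u v

-- Indecomposable: for every partition of the set of fibers into two nonempty
-- parts (a Bool-valued map constant on fibers taking both values), some
-- interspace between a fiber of one part and a fiber of the other part is
-- not uniform.
Indecomposable : ∀ {n r} → CC n r → Set
Indecomposable {n} C = ∀ (P : Fin n → Bool) →
  (∀ x y → SameFiber C x y → P x ≡ P y) →
  (∃ λ x → ∃ λ y → P x ≢ P y) →
  ¬ (∀ x y x' y' → P x ≢ P y → SameFiber C x x' → SameFiber C y y' →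
       col C x y ≡ col C x' y')

-- D (on Fin m with s basis relations) is (a copy of) C ∖ X, where X is the
-- fiber of x₀: ι identifies the points of D with the points of V ∖ X, and
-- g identifies the basis relations of D with the basis relations of C
-- contained in (V ∖ X)².
record IsRemoval {n r m s} (C : CC n r) (x₀ : Fin n) (D : CC m s) : Set where
  field
    ι : Fin m → Fin n
    ι-inj : ∀ a b → ι a ≡ ι b → a ≡ b
    ι-range : ∀ y → (¬ SameFiber C y x₀ → ∃ λ a → ι a ≡ y)
    ι-avoid : ∀ a → ¬ SameFiber C (ι a) x₀
    g : Fin s → Fin r
    g-inj : ∀ i j → g i ≡ g j → i ≡ j
    g-col : ∀ a b → col C (ι a) (ι b) ≡ g (col D a b)

-- Write X = {x 0, x 1} for the fibre of x₀. Indecomposability yields a point y outside X with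
-- c(x 0, y) ≠ c(x 1, y); then x i is the only successor of y in colour c(y, x i), and by coherence
-- every z in the fibre of y has a unique such successor π z i, with {π z 0, π z 1} = X. So the
-- colours between X and the other points are functions of the colours at y, and the intersection
-- numbers of C split into a part over X, computed through y, and the intersection numbers of C ∖ X.
-- An algebraic isomorphism C → C′ therefore restricts to C ∖ X → C′ ∖ X′, and a combinatorial
-- isomorphism of the restriction extends to X by sending x i to the successor of the image of y in
-- the image colour. Conversely an algebraic isomorphism C ∖ X → D′ extends to one of C onto D′ with
-- two points attached through an image of y, and a combinatorial isomorphism of C restricts to C ∖ X.

module Submission where

open import Data.Fin using (Fin; zero; suc; _≟_; cast; _↑ˡ_; _↑ʳ_; splitAt; join)
open import Data.Fin.Patterns using (0F; 1F)
open import Data.Fin.Properties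
  using (suc-injective; ¬∀⟶∃¬; cast-involutive; any?
        ; splitAt-join; join-splitAt; splitAt-↑ˡ; splitAt-↑ʳ; ↑ˡ-injective; ↑ʳ-injective)
open import Data.List using (List; []; _∷_; _++_; length; filter; allFin; map; tabulate; lookup)
open import Data.List.Properties using (length-map; length-++; length-tabulate)
open import Data.List.Membership.Propositional using (_∈_)
open import Data.List.Membership.Propositional.Properties
  using (∈-filter⁺; ∈-filter⁻; ∈-allFin; ∈-map⁺; ∈-map⁻; ∈-++⁺ˡ; ∈-++⁺ʳ; ∈-++⁻; ∈-lookup)
open import Data.List.Membership.Propositional.Properties.WithK using (unique∧set⇒bag)
open import Data.List.Relation.Binary.BagAndSetEquality using (∼bag⇒↭)
open import Data.List.Relation.Binary.Permutation.Propositional.Properties using (↭-length)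
import Data.List.Relation.Unary.Any as Any
open Any using (here; there)
open import Data.List.Relation.Unary.Any.Properties using (lookup-index)
open import Data.List.Relation.Unary.All using ([]; _∷_)
open import Data.List.Relation.Unary.All.Properties using (All¬⇒¬Any)
open import Data.List.Relation.Unary.AllPairs using ([]; _∷_)
open import Data.List.Relation.Unary.Unique.Propositional using (Unique)
import Data.List.Relation.Unary.Unique.Propositional.Properties as Unique
open import Data.Nat using (ℕ; zero; suc; _+_; _*_; _≤_; _<_; _>_; z≤n; s≤s)
open import Data.Nat.Properties using (+-comm; +-identityʳ; *-identityˡ; <-irrefl; +-*-semiring)
open import Algebra.Properties.Semiring.Sum +-*-semiring
  using (sum-syntax; ∑-comm; *-distribˡ-sum; sum-cong-≗; sum-replicate-zero)
open import Data.Nat.Solver using (module +-*-Solver)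
open +-*-Solver using (solve; _:*_; _:=_)
open import Data.Product using (∃; ∃₂; _×_; _,_; proj₁; proj₂)
open import Data.Sum using (_⊎_; inj₁; inj₂)
open import Function using (_∘_; mk⇔)
open import Function.Bundles using (Bijection; _⤖_; mk⤖; _⇔_)
open import Function.Construct.Identity using (⤖-id)
open import Function.Definitions using (Injective)
open import Level using (0ℓ)
open import Relation.Binary.PropositionalEquality
  using (_≡_; _≢_; refl; sym; trans; cong; cong₂; subst; subst₂; module ≡-Reasoning)
open import Relation.Nullary using (Dec; yes; no; ¬_; does; contradiction)
open import Relation.Nullary.Decidable using (_×-dec_; _⊎-dec_; ¬?; dec-true; dec-false)
open import Relation.Unary using (Pred; Decidable)
open import Defs

private variable
  n k m s : ℕ

[_] : {A : Set} → Dec A → ℕ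
[ yes _ ] = 1
[ no _ ] = 0

[]-cong : {A B : Set} (a? : Dec A) (b? : Dec B) → (A → B) → (B → A) → [ a? ] ≡ [ b? ]
[]-cong (yes _) (yes _) _ _ = refl
[]-cong (no _) (no _) _ _ = refl
[]-cong (yes a) (no ¬b) a⇒b _ = contradiction (a⇒b a) ¬b
[]-cong (no ¬a) (yes b) _ b⇒a = contradiction (b⇒a b) ¬a

[×]≡* : {A B : Set} (a? : Dec A) (b? : Dec B) → [ a? ×-dec b? ] ≡ [ a? ] * [ b? ]
[×]≡* (yes _) (yes _) = refl
[×]≡* (yes _) (no _) = refl
[×]≡* (no _) (yes _) = refl
[×]≡* (no _) (no _) = refl

elements : {P : Pred (Fin n) 0ℓ} → Decidable P → List (Fin n)
elements {n = n} P? = filter P? (allFin n)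

elements-unique : {P : Pred (Fin n) 0ℓ} (P? : Decidable P) → Unique (elements P?)
elements-unique {n = n} P? = Unique.filter⁺ P? (Unique.allFin⁺ n)

∈-elements : {P : Pred (Fin n) 0ℓ} (P? : Decidable P) → ∀ {x} → P x → x ∈ elements P?
∈-elements P? {x} = ∈-filter⁺ P? (∈-allFin x)

∈-elements⁻ : {P : Pred (Fin n) 0ℓ} (P? : Decidable P) → ∀ {x} → x ∈ elements P? → P x
∈-elements⁻ {n = n} P? {x} = proj₂ ∘ ∈-filter⁻ P? {x} {allFin n}

number≡length : {P : Pred (Fin n) 0ℓ} (P? : Decidable P) {xs : List (Fin n)} → Unique xs →
  (∀ {x} → P x → x ∈ xs) → (∀ {x} → x ∈ xs → P x) → number P? ≡ length xs
number≡length P? unique into from = ↭-length (∼bag⇒↭ (unique∧set⇒bag (elements-unique P?) unique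
  (mk⇔ (into ∘ ∈-elements⁻ P?) (∈-elements P? ∘ from))))

number-cong : {P Q : Pred (Fin n) 0ℓ} (P? : Decidable P) (Q? : Decidable Q) →
  (∀ {x} → P x → Q x) → (∀ {x} → Q x → P x) → number P? ≡ number Q?
number-cong P? Q? P⇒Q Q⇒P =
  number≡length P? (elements-unique Q?) (∈-elements Q? ∘ P⇒Q) (Q⇒P ∘ ∈-elements⁻ Q?)

number-≟-cong : {f f′ h h′ : Fin n → Fin s} → (∀ w → f w ≡ f′ w) → (∀ w → h w ≡ h′ w) → ∀ R S →
  number (λ w → f w ≟ R ×-dec h w ≟ S) ≡ number (λ w → f′ w ≟ R ×-dec h′ w ≟ S)
number-≟-cong {f = f} {f′} {h} {h′} f≗f′ h≗h′ R S =
  number-cong (λ w → f w ≟ R ×-dec h w ≟ S) (λ w → f′ w ≟ R ×-dec h′ w ≟ S)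
  (λ {w} (fw , hw) → trans (sym (f≗f′ w)) fw , trans (sym (h≗h′ w)) hw)
  (λ {w} (fw , hw) → trans (f≗f′ w) fw , trans (h≗h′ w) hw)

image : {P : Pred (Fin n) 0ℓ} (h : Fin k → Fin n) → Decidable P → List (Fin n)
image h P? = map h (elements (P? ∘ h))

image-unique : {P : Pred (Fin n) 0ℓ} (h : Fin k → Fin n) → Injective _≡_ _≡_ h → (P? : Decidable P) → Unique (image h P?)
image-unique h h-injective P? = Unique.map⁺ h-injective (elements-unique (P? ∘ h))

∈-image : {P : Pred (Fin n) 0ℓ} (h : Fin k → Fin n) (P? : Decidable P) → ∀ {i} → P (h i) → h i ∈ image h P?
∈-image h P? P[hi] = ∈-map⁺ h (∈-elements (P? ∘ h) P[hi])

∈-image⁻ : {P : Pred (Fin n) 0ℓ} (h : Fin k → Fin n) (P? : Decidable P) → ∀ {z} → z ∈ image h P? → ∃ λ i → h i ≡ z × P z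
∈-image⁻ h P? z∈ with ∈-map⁻ h z∈
... | i , i∈ , refl = i , refl , ∈-elements⁻ (P? ∘ h) i∈

number-image : {P : Pred (Fin n) 0ℓ} (h : Fin k → Fin n) → Injective _≡_ _≡_ h → (P? : Decidable P) →
  (∀ {z} → P z → ∃ λ i → h i ≡ z) → number (P? ∘ h) ≡ number P?
number-image {P = P} h h-injective P? onto =
  sym (trans (number≡length P? (image-unique h h-injective P?) into (proj₂ ∘ proj₂ ∘ ∈-image⁻ h P?))
    (length-map h (elements (P? ∘ h))))
  where
  into : ∀ {z} → P z → z ∈ image h P?
  into Pz with onto Pz
  ... | i , refl = ∈-image h P? Pz

record DisjointCover {n k m} (e : Fin k → Fin n) (ι : Fin m → Fin n) : Set where
  field
    e-injective : Injective _≡_ _≡_ e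
    ι-injective : Injective _≡_ _≡_ ι
    disjoint : ∀ i a → e i ≢ ι a
    cover : ∀ z → (∃ λ i → e i ≡ z) ⊎ (∃ λ a → ι a ≡ z)

number-cover : {P : Pred (Fin n) 0ℓ} {e : Fin k → Fin n} {ι : Fin m → Fin n} →
  DisjointCover e ι → (P? : Decidable P) → number P? ≡ number (P? ∘ e) + number (P? ∘ ι)
number-cover {P = P} {e} {ι} cover-eι P? = begin
  number P?
    ≡⟨ number≡length P? (Unique.++⁺ (image-unique e e-injective P?) (image-unique ι ι-injective P?) disjoint′) into from ⟩
  length (image e P? ++ image ι P?)
    ≡⟨ length-++ (image e P?) ⟩
  length (image e P?) + length (image ι P?)
    ≡⟨ cong₂ _+_ (length-map e (elements (P? ∘ e))) (length-map ι (elements (P? ∘ ι))) ⟩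
  number (P? ∘ e) + number (P? ∘ ι) ∎
  where
  open ≡-Reasoning
  open DisjointCover cover-eι
  disjoint′ : ∀ {z} → ¬ (z ∈ image e P? × z ∈ image ι P?)
  disjoint′ (z∈e , z∈ι) with ∈-image⁻ e P? z∈e | ∈-image⁻ ι P? z∈ι
  ... | i , refl , _ | a , ιa≡ei , _ = disjoint i a (sym ιa≡ei)
  into : ∀ {z} → P z → z ∈ image e P? ++ image ι P?
  into {z} Pz with cover z
  ... | inj₁ (i , refl) = ∈-++⁺ˡ (∈-image e P? Pz)
  ... | inj₂ (a , refl) = ∈-++⁺ʳ (image e P?) (∈-image ι P? Pz)
  from : ∀ {z} → z ∈ image e P? ++ image ι P? → P z
  from z∈ with ∈-++⁻ (image e P?) z∈
  ... | inj₁ z∈e = proj₂ (proj₂ (∈-image⁻ e P? z∈e))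
  ... | inj₂ z∈ι = proj₂ (proj₂ (∈-image⁻ ι P? z∈ι))

number-all : {P : Pred (Fin n) 0ℓ} (P? : Decidable P) → (∀ x → P x) → number P? ≡ n
number-all {n = n} P? all = trans (number≡length P? (Unique.allFin⁺ n) (λ {x} _ → ∈-allFin x) (λ {x} _ → all x))
  (length-tabulate (λ i → i))

∃⇒0<number : {P : Pred (Fin n) 0ℓ} (P? : Decidable P) → ∀ {x} → P x → 0 < number P?
∃⇒0<number P? Px with elements P? | ∈-elements P? Px
... | _ ∷ _ | _ = s≤s z≤n

0<number⇒∃ : {P : Pred (Fin n) 0ℓ} (P? : Decidable P) → 0 < number P? → ∃ P
0<number⇒∃ P? 0<# with elements P? | ∈-elements⁻ P?
... | x ∷ _ | sound = x , sound (here refl)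

distinct⇒2≤number : {P : Pred (Fin n) 0ℓ} (P? : Decidable P) → ∀ {x y} → x ≢ y → P x → P y → 2 ≤ number P?
distinct⇒2≤number P? x≢y Px Py with elements P? | ∈-elements P? Px | ∈-elements P? Py
... | _ ∷ _ ∷ _ | _ | _ = s≤s (s≤s z≤n)
... | _ ∷ [] | here refl | here refl = contradiction refl x≢y

2≤number⇒distinct : {P : Pred (Fin n) 0ℓ} (P? : Decidable P) → 2 ≤ number P? → ∃₂ λ x y → x ≢ y × P x × P y
2≤number⇒distinct P? 2≤# with elements P? | elements-unique P? | ∈-elements⁻ P? | 2≤#
... | x ∷ y ∷ _ | (x≢y ∷ _) ∷ _ | sound | _ = x , y , x≢y , sound (here refl) , sound (there (here refl))
... | _ ∷ [] | _ | _ | s≤s ()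

number≡1⇒≡ : {P : Pred (Fin n) 0ℓ} (P? : Decidable P) → number P? ≡ 1 → ∀ {x y} → P x → P y → x ≡ y
number≡1⇒≡ P? #≡1 {x} {y} Px Py with x ≟ y
... | yes x≡y = x≡y
... | no x≢y with distinct⇒2≤number P? x≢y Px Py
... | 2≤# rewrite #≡1 = contradiction 2≤# λ { (s≤s ()) }

number≡∑ : {P : Pred (Fin n) 0ℓ} (P? : Decidable P) → number P? ≡ ∑[ w < n ] [ P? w ]
number≡∑ P? = count-tabulate (λ w → w)
  where
  count-tabulate : ∀ {j} (f : Fin j → Fin _) → length (filter P? (tabulate f)) ≡ ∑[ i < j ] [ P? (f i) ]
  count-tabulate {zero} f = refl
  count-tabulate {suc j} f with P? (f zero)
  ... | yes _ = cong suc (count-tabulate (f ∘ suc))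
  ... | no _ = count-tabulate (f ∘ suc)

∑-pick : (z : Fin s) (g : Fin s → ℕ) → ∑[ R < s ] ([ z ≟ R ] * g R) ≡ g z
∑-pick {suc s} zero g = trans (cong₂ _+_ (*-identityˡ (g zero)) (sum-replicate-zero s)) (+-identityʳ (g zero))
∑-pick {suc s} (suc z) g = trans (sum-cong-≗ λ R → cong (_* g (suc R)) (sym ([]-cong (z ≟ R) (suc z ≟ suc R) (cong suc) suc-injective)))
  (∑-pick z (g ∘ suc))

number-by-colours : {Q : Fin s → Fin s → Set} (Q? : ∀ R S → Dec (Q R S)) (f h : Fin n → Fin s) →
  number (λ w → Q? (f w) (h w)) ≡ ∑[ R < s ] ∑[ S < s ] ([ Q? R S ] * number (λ w → f w ≟ R ×-dec h w ≟ S))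
number-by-colours {s = s} {n = n} Q? f h = begin
  number (λ w → Q? (f w) (h w))
    ≡⟨ number≡∑ (λ w → Q? (f w) (h w)) ⟩
  ∑[ w < n ] [ Q? (f w) (h w) ]
    ≡⟨ sum-cong-≗ (λ w → expand (f w) (h w)) ⟨
  ∑[ w < n ] ∑[ R < s ] ∑[ S < s ] ([ Q? R S ] * [ f w ≟ R ×-dec h w ≟ S ])
    ≡⟨ ∑-comm (λ w R → ∑[ S < s ] ([ Q? R S ] * [ f w ≟ R ×-dec h w ≟ S ])) ⟩
  ∑[ R < s ] ∑[ w < n ] ∑[ S < s ] ([ Q? R S ] * [ f w ≟ R ×-dec h w ≟ S ])
    ≡⟨ sum-cong-≗ (λ R → ∑-comm (λ w S → [ Q? R S ] * [ f w ≟ R ×-dec h w ≟ S ])) ⟩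
  ∑[ R < s ] ∑[ S < s ] ∑[ w < n ] ([ Q? R S ] * [ f w ≟ R ×-dec h w ≟ S ])
    ≡⟨ sum-cong-≗ (λ R → sum-cong-≗ λ S →
         trans (sym (*-distribˡ-sum [ Q? R S ] (λ w → [ f w ≟ R ×-dec h w ≟ S ])))
           (cong ([ Q? R S ] *_) (sym (number≡∑ (λ w → f w ≟ R ×-dec h w ≟ S))))) ⟩
  ∑[ R < s ] ∑[ S < s ] ([ Q? R S ] * number (λ w → f w ≟ R ×-dec h w ≟ S)) ∎
  where
  open ≡-Reasoning
  expand : ∀ a b → ∑[ R < s ] ∑[ S < s ] ([ Q? R S ] * [ a ≟ R ×-dec b ≟ S ]) ≡ [ Q? a b ]
  expand a b = begin
    ∑[ R < s ] ∑[ S < s ] ([ Q? R S ] * [ a ≟ R ×-dec b ≟ S ])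
      ≡⟨ sum-cong-≗ (λ R → sum-cong-≗ λ S → reorder R S) ⟩
    ∑[ R < s ] ∑[ S < s ] ([ a ≟ R ] * ([ b ≟ S ] * [ Q? R S ]))
      ≡⟨ sum-cong-≗ (λ R → sym (*-distribˡ-sum [ a ≟ R ] (λ S → [ b ≟ S ] * [ Q? R S ]))) ⟩
    ∑[ R < s ] ([ a ≟ R ] * ∑[ S < s ] ([ b ≟ S ] * [ Q? R S ]))
      ≡⟨ sum-cong-≗ (λ R → cong ([ a ≟ R ] *_) (∑-pick b (λ S → [ Q? R S ]))) ⟩
    ∑[ R < s ] ([ a ≟ R ] * [ Q? R b ])
      ≡⟨ ∑-pick a (λ R → [ Q? R b ]) ⟩
    [ Q? a b ] ∎
    where
    reorder : ∀ R S → [ Q? R S ] * [ a ≟ R ×-dec b ≟ S ] ≡ [ a ≟ R ] * ([ b ≟ S ] * [ Q? R S ])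
    reorder R S = trans (cong ([ Q? R S ] *_) ([×]≡* (a ≟ R) (b ≟ S)))
      (solve 3 (λ q x y → q :* (x :* y) := x :* (y :* q)) refl [ Q? R S ] [ a ≟ R ] [ b ≟ S ])

enumerate : {P : Pred (Fin n) 0ℓ} (P? : Decidable P) → Fin (number P?) → Fin n
enumerate P? = lookup (elements P?)

enumerate-injective : {P : Pred (Fin n) 0ℓ} (P? : Decidable P) → Injective _≡_ _≡_ (enumerate P?)
enumerate-injective P? = lookup-injective (elements-unique P?)
  where
  lookup-injective : ∀ {xs : List (Fin _)} → Unique xs → Injective _≡_ _≡_ (lookup xs)
  lookup-injective {_ ∷ _} _ {zero} {zero} _ = refl
  lookup-injective {_ ∷ _} (x∉ ∷ _) {zero} {suc j} x≡ = contradiction (subst (_∈ _) (sym x≡) (∈-lookup j)) (All¬⇒¬Any x∉)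
  lookup-injective {_ ∷ _} (x∉ ∷ _) {suc i} {zero} ≡x = contradiction (subst (_∈ _) ≡x (∈-lookup i)) (All¬⇒¬Any x∉)
  lookup-injective {_ ∷ _} (_ ∷ unique) {suc i} {suc j} eq = cong suc (lookup-injective unique eq)

enumerate-sound : {P : Pred (Fin n) 0ℓ} (P? : Decidable P) → ∀ i → P (enumerate P? i)
enumerate-sound P? i = ∈-elements⁻ P? (∈-lookup i)

enumerate-complete : {P : Pred (Fin n) 0ℓ} (P? : Decidable P) → ∀ {z} → P z → ∃ λ i → enumerate P? i ≡ z
enumerate-complete P? Pz = Any.index z∈ , sym (lookup-index z∈)
  where z∈ = ∈-elements P? Pz

mk⤖′ : ∀ {k l} (h : Fin k → Fin l) → Injective _≡_ _≡_ h → (∀ z → ∃ λ i → h i ≡ z) → Fin k ⤖ Fin l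
mk⤖′ h injective onto = mk⤖ (injective , λ z → proj₁ (onto z) , λ { refl → proj₂ (onto z) })

module Configuration {n r} (C : CC n r) where
  private
    c = col C

  triangle⇒0<p : ∀ {u v w R S} → c u w ≡ R → c w v ≡ S → 0 < p c u v R S
  triangle⇒0<p {u} {v} {R = R} {S} uw wv = ∃⇒0<number (λ w → (c u w ≟ R) ×-dec (c w v ≟ S)) (uw , wv)

  0<p⇒triangle : ∀ {u v R S} → 0 < p c u v R S → ∃ λ w → c u w ≡ R × c w v ≡ S
  0<p⇒triangle {u} {v} {R} {S} = 0<number⇒∃ (λ w → (c u w ≟ R) ×-dec (c w v ≟ S))

  triangle-transfer : ∀ {u v u′ v′ R S w} → c u v ≡ c u′ v′ → c u w ≡ R → c w v ≡ S →
    ∃ λ w′ → c u′ w′ ≡ R × c w′ v′ ≡ S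
  triangle-transfer {u} {v} {u′} {v′} {R} {S} uv≡ uw wv =
    0<p⇒triangle (subst (0 <_) (coh C R S u v u′ v′ uv≡) (triangle⇒0<p uw wv))

  source-fiber : ∀ {u v u′ v′} → c u v ≡ c u′ v′ → SameFiber C u u′
  source-fiber {u} {v} uv≡ with triangle-transfer {R = c u u} uv≡ refl refl
  ... | w , u′w , _ with loops C u _ w u′w
  ... | refl = sym u′w

  target-fiber : ∀ {u v u′ v′} → c u v ≡ c u′ v′ → SameFiber C v v′
  target-fiber {u} {v} {u′} {v′} = source-fiber ∘ transp C u v u′ v′

  out-neighbour : ∀ {z s t} → SameFiber C z s → ∃ λ w → c z w ≡ c s t
  out-neighbour {t = t} zs with triangle-transfer {w = t} (sym zs) refl refl
  ... | w , zw , _ = w , zw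

  in-neighbour : ∀ {z s t} → SameFiber C z t → ∃ λ w → c w z ≡ c s t
  in-neighbour {z} {s} {t} zt with out-neighbour {t = s} zt
  ... | w , zw = w , transp C z w t s zw

  SoleSuccessor : Fin n → Fin n → Set
  SoleSuccessor u w = ∀ {t} → c u t ≡ c u w → t ≡ w

  SolePredecessor : Fin n → Fin n → Set
  SolePredecessor u w = ∀ {t} → c t u ≡ c w u → t ≡ w

  sole⇒p≡1 : ∀ {u w} → SoleSuccessor u w → p c u u (c u w) (c w u) ≡ 1
  sole⇒p≡1 {u} {w} sole = number≡length (λ t → (c u t ≟ c u w) ×-dec (c t u ≟ c w u)) ([] ∷ [])
    (λ (ut , _) → here (sole ut)) λ { (here refl) → refl , refl }

module AlgebraicIsomorphism {n r n′ r′} {C : CC n r} {C′ : CC n′ r′} (a : AlgIso C C′) where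
  private
    c = col C
    c′ = col C′
    module C = Configuration C
    module C′ = Configuration C′

  to : Fin r → Fin r′
  to = Bijection.to (f a)

  from : Fin r′ → Fin r
  from T = proj₁ (Bijection.surjective (f a) T)

  to-from : ∀ T → to (from T) ≡ T
  to-from T = proj₂ (Bijection.surjective (f a) T) refl

  to-injective : ∀ {R S} → to R ≡ to S → R ≡ S
  to-injective = Bijection.injective (f a)

  from-to : ∀ R → from (to R) ≡ R
  from-to R = to-injective (to-from (to R))

  from-colour : ∀ {u v u′ v′} → c′ u′ v′ ≡ to (c u v) → from (c′ u′ v′) ≡ c u v
  from-colour uv′ = trans (cong from uv′) (from-to _)

  triangle-to : ∀ {u v u′ v′ R S w} → c′ u′ v′ ≡ to (c u v) → c u w ≡ R → c w v ≡ S →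
    ∃ λ w′ → c′ u′ w′ ≡ to R × c′ w′ v′ ≡ to S
  triangle-to {u} {v} {u′} {v′} {R} {S} uv′ uw wv =
    C′.0<p⇒triangle (subst (0 <_) (pres a R S u v u′ v′ uv′) (C.triangle⇒0<p uw wv))

  triangle-from : ∀ {u v u′ v′ R S w′} → c′ u′ v′ ≡ to (c u v) → c′ u′ w′ ≡ to R → c′ w′ v′ ≡ to S →
    ∃ λ w → c u w ≡ R × c w v ≡ S
  triangle-from {u} {v} {u′} {v′} {R} {S} uv′ uw′ wv′ =
    C.0<p⇒triangle (subst (0 <_) (sym (pres a R S u v u′ v′ uv′)) (C′.triangle⇒0<p uw′ wv′))

  loop-to : ∀ {u u′ v′} → c′ u′ v′ ≡ to (c u u) → u′ ≡ v′
  loop-to {u} {u′} {v′} uv′ with triangle-from {R = c u u} {S = from (c′ v′ v′)} {w′ = v′} uv′ uv′ (sym (to-from _))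
  ... | w , uw , wu with loops C u u w uw
  ... | refl = loops C′ v′ u′ v′ (trans uv′ (trans (cong to wu) (to-from _)))

  source-fiber-to : ∀ {u v u′ v′} → c′ u′ v′ ≡ to (c u v) → c′ u′ u′ ≡ to (c u u)
  source-fiber-to uv′ with triangle-to uv′ refl refl
  ... | w′ , uw′ , _ with loop-to uw′
  ... | refl = uw′

  target-fiber-to : ∀ {u v u′ v′} → c′ u′ v′ ≡ to (c u v) → c′ v′ v′ ≡ to (c v v)
  target-fiber-to uv′ with triangle-to uv′ refl refl
  ... | w′ , _ , wv′ with loop-to wv′
  ... | refl = wv′

  transpose-to : ∀ {u v u′ v′} → c′ u′ v′ ≡ to (c u v) → c′ v′ u′ ≡ to (c v u)
  transpose-to {u} {v} {u′} {v′} uv′ with triangle-to {R = c u v} {S = c v u} (source-fiber-to uv′) refl refl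
  ... | w′ , uw′ , wu′ = trans (sym (transp C′ u′ w′ u′ v′ (trans uw′ (sym uv′)))) wu′

  sole-successor-to : ∀ {u w u′ w₁′ w₂′} → C.SoleSuccessor u w → c′ u′ u′ ≡ to (c u u) →
    c′ u′ w₁′ ≡ to (c u w) → c′ u′ w₂′ ≡ to (c u w) → w₁′ ≡ w₂′
  sole-successor-to {u} {w} {u′} sole uu′ uw₁′ uw₂′ =
    number≡1⇒≡ (λ t → (c′ u′ t ≟ to (c u w)) ×-dec (c′ t u′ ≟ to (c w u)))
      (trans (sym (pres a _ _ u u u′ u′ uu′)) (C.sole⇒p≡1 sole))
      (uw₁′ , transpose-to uw₁′) (uw₂′ , transpose-to uw₂′)

  via-sole-successor : ∀ {u v w u′ v′ w′} → C.SoleSuccessor u w →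
    c′ u′ v′ ≡ to (c u v) → c′ u′ w′ ≡ to (c u w) → c′ w′ v′ ≡ to (c w v)
  via-sole-successor sole uv′ uw′ with triangle-from uv′ uw′ (sym (to-from _))
  ... | t , ut , tv with sole ut
  ... | refl = trans (sym (to-from _)) (cong to (sym tv))

  via-sole-predecessor : ∀ {u v w u′ v′ w′} → C.SolePredecessor u w →
    c′ v′ u′ ≡ to (c v u) → c′ w′ u′ ≡ to (c w u) → c′ v′ w′ ≡ to (c v w)
  via-sole-predecessor sole vu′ wu′ with triangle-from vu′ (sym (to-from _)) wu′
  ... | t , vt , tu with sole tu
  ... | refl = trans (sym (to-from _)) (cong to (sym vt))

  ∃pair-from : ∀ u′ v′ → ∃ λ u → ∃ λ v → c′ u′ v′ ≡ to (c u v)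
  ∃pair-from u′ v′ with nonempty C (from (c′ u′ v′))
  ... | u , v , uv≡ = u , v , trans (sym (to-from _)) (cong to (sym uv≡))

  ∃successor-to : ∀ {u u′} → c′ u′ u′ ≡ to (c u u) → ∀ v → ∃ λ v′ → c′ u′ v′ ≡ to (c u v)
  ∃successor-to {u} uu′ v with nonempty C′ (to (c u v))
  ... | s′ , t′ , st′ with C′.out-neighbour {t = t′} (trans uu′ (sym (source-fiber-to st′)))
  ... | v′ , uv′ = v′ , trans uv′ st′

  ∃predecessor-to : ∀ {v v′} → c′ v′ v′ ≡ to (c v v) → ∀ u → ∃ λ u′ → c′ u′ v′ ≡ to (c u v)
  ∃predecessor-to {v} vv′ u with nonempty C′ (to (c u v))
  ... | s′ , t′ , st′ with C′.in-neighbour {s = s′} (trans vv′ (sym (target-fiber-to st′)))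
  ... | u′ , uv′ = u′ , trans uv′ st′

  ∃successor-from : ∀ {u u′} → c′ u′ u′ ≡ to (c u u) → ∀ v′ → ∃ λ v → c′ u′ v′ ≡ to (c u v)
  ∃successor-from {u} {u′} uu′ v′ with ∃pair-from u′ v′
  ... | s₁ , t₁ , uv′ with C.out-neighbour {u} {s₁} {t₁} (to-injective (trans (sym uu′) (source-fiber-to uv′)))
  ... | v , uv≡ = v , trans uv′ (cong to (sym uv≡))

  ∃predecessor-from : ∀ {v v′} → c′ v′ v′ ≡ to (c v v) → ∀ u′ → ∃ λ u → c′ u′ v′ ≡ to (c u v)
  ∃predecessor-from {v} {v′} vv′ u′ with ∃pair-from u′ v′
  ... | s₁ , t₁ , uv′ with C.in-neighbour {v} {s₁} {t₁} (to-injective (trans (sym vv′) (target-fiber-to uv′)))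
  ... | u , uv≡ = u , trans uv′ (cong to (sym uv≡))

  count-to : ∀ {u v u′ v′} → c′ u′ v′ ≡ to (c u v) → {Q : Fin r → Fin r → Set} (Q? : ∀ R S → Dec (Q R S)) →
    number (λ w → Q? (c u w) (c w v)) ≡ number (λ w′ → Q? (from (c′ u′ w′)) (from (c′ w′ v′)))
  count-to {u} {v} {u′} {v′} uv′ Q? =
    trans (number-by-colours Q? (c u) (λ w → c w v))
    (trans (sum-cong-≗ λ R → sum-cong-≗ λ S → cong ([ Q? R S ] *_) (p≡ R S))
      (sym (number-by-colours Q? (from ∘ c′ u′) (λ w′ → from (c′ w′ v′)))))
    where
    p≡ : ∀ R S → p c u v R S ≡ number (λ w′ → from (c′ u′ w′) ≟ R ×-dec from (c′ w′ v′) ≟ S)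
    p≡ R S = trans (pres a R S u v u′ v′ uv′)
      (number-cong (λ w′ → (c′ u′ w′ ≟ to R) ×-dec (c′ w′ v′ ≟ to S))
                   (λ w′ → from (c′ u′ w′) ≟ R ×-dec from (c′ w′ v′) ≟ S)
        (λ (uw′ , wv′) → trans (cong from uw′) (from-to R) , trans (cong from wv′) (from-to S))
        (λ (uw′ , wv′) → trans (sym (to-from _)) (cong to uw′) , trans (sym (to-from _)) (cong to wv′)))

record Mimic {n r N} (C : CC n r) (col″ : Fin N → Fin N → Fin r) (u″ v″ : Fin N) : Set where
  field
    u v : Fin n
    colour : col C u v ≡ col″ u″ v″
    colourᵀ : col C v u ≡ col″ v″ u″
    loop⇒ : u ≡ v → u″ ≡ v″
    loop⇐ : u″ ≡ v″ → u ≡ v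
    p-eq : ∀ R S → p (col C) u v R S ≡ p col″ u″ v″ R S

module Mimicry {n r N} (C : CC n r) (col″ : Fin N → Fin N → Fin r)
  (mimic : ∀ u″ v″ → Mimic C col″ u″ v″) (onto : ∀ T → ∃ λ u″ → ∃ λ v″ → col″ u″ v″ ≡ T) where
  open Mimic

  mimic-CC : CC N r
  mimic-CC = record
    { col = col″
    ; nonempty = onto
    ; loops = λ z u″ v″ uv≡zz → loop⇒ (mimic u″ v″) (loops C (u (mimic z z)) _ _
        (trans (colour (mimic u″ v″)) (trans uv≡zz (trans (sym (colour (mimic z z)))
          (cong (col C _) (sym (loop⇐ (mimic z z) refl)))))))
    ; transp = λ u″ v″ u‴ v‴ uv≡ → trans (sym (colourᵀ (mimic u″ v″)))
        (trans (transp C _ _ _ _ (lift uv≡)) (colourᵀ (mimic u‴ v‴)))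
    ; coh = λ R S u″ v″ u‴ v‴ uv≡ → trans (sym (p-eq (mimic u″ v″) R S))
        (trans (coh C R S _ _ _ _ (lift uv≡)) (p-eq (mimic u‴ v‴) R S))
    }
    where
    lift : ∀ {u″ v″ u‴ v‴} → col″ u″ v″ ≡ col″ u‴ v‴ →
      col C (u (mimic u″ v″)) (v (mimic u″ v″)) ≡ col C (u (mimic u‴ v‴)) (v (mimic u‴ v‴))
    lift {u″} {v″} {u‴} {v‴} uv≡ = trans (colour (mimic u″ v″)) (trans uv≡ (sym (colour (mimic u‴ v‴))))

  mimic-iso : AlgIso C mimic-CC
  mimic-iso = record
    { f = ⤖-id (Fin r)
    ; pres = λ R S u₁ v₁ u″ v″ uv″≡ → trans (coh C R S u₁ v₁ _ _ (trans (sym uv″≡) (sym (colour (mimic u″ v″)))))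
        (p-eq (mimic u″ v″) R S)
    }

module Subconfiguration {n r m s} (C : CC n r) {ι : Fin m → Fin n} {h : Fin s → Fin r}
  (ι-injective : Injective _≡_ _≡_ ι) (h-injective : Injective _≡_ _≡_ h)
  (colD : Fin m → Fin m → Fin s) (col-ι : ∀ a b → col C (ι a) (ι b) ≡ h (colD a b))
  (closed : ∀ {a w R} → col C (ι a) w ≡ h R → ∃ λ b → ι b ≡ w) where
  private
    c = col C

  p-sub : ∀ a b R S → p colD a b R S ≡ p c (ι a) (ι b) (h R) (h S)
  p-sub a b R S = trans
    (number-cong (λ k → (colD a k ≟ R) ×-dec (colD k b ≟ S)) (triangle? ∘ ι)
      (λ (ak , kb) → trans (col-ι a _) (cong h ak) , trans (col-ι _ b) (cong h kb))
      (λ (ak , kb) → h-injective (trans (sym (col-ι a _)) ak) , h-injective (trans (sym (col-ι _ b)) kb)))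
    (number-image ι ι-injective triangle? (closed ∘ proj₁))
    where
    triangle? : Decidable λ w → c (ι a) w ≡ h R × c w (ι b) ≡ h S
    triangle? w = (c (ι a) w ≟ h R) ×-dec (c w (ι b) ≟ h S)

  subconfiguration : (∀ R → ∃ λ a → ∃ λ b → colD a b ≡ R) → CC m s
  subconfiguration nonempty-sub = record
    { col = colD
    ; nonempty = nonempty-sub
    ; loops = λ z a b ab≡zz → ι-injective (loops C (ι z) (ι a) (ι b) (lift ab≡zz))
    ; transp = λ a b a′ b′ ab≡ → h-injective (trans (sym (col-ι b a)) (trans (transp C _ _ _ _ (lift ab≡)) (col-ι b′ a′)))
    ; coh = λ R S a b a′ b′ ab≡ → trans (p-sub a b R S) (trans (coh C (h R) (h S) _ _ _ _ (lift ab≡)) (sym (p-sub a′ b′ R S)))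
    }
    where
    lift : ∀ {a b a′ b′} → colD a b ≡ colD a′ b′ → c (ι a) (ι b) ≡ c (ι a′) (ι b′)
    lift {a} {b} {a′} {b′} ab≡ = trans (col-ι a b) (trans (cong h ab≡) (sym (col-ι a′ b′)))

module Removal {n r m s} {C : CC n r} {x₀ : Fin n} {D : CC m s} (removal : IsRemoval C x₀ D) where
  open IsRemoval removal
  open Configuration C

  colour-avoids : ∀ {u w R} → col C u w ≡ g R → ¬ SameFiber C w x₀
  colour-avoids {R = R} uw≡ with nonempty D R
  ... | a′ , b′ , refl = λ wX → ι-avoid b′ (trans (sym (target-fiber (trans uw≡ (sym (g-col a′ b′))))) wX)

  p-removal : ∀ a b R S → p (col D) a b R S ≡ p (col C) (ι a) (ι b) (g R) (g S)
  p-removal = Subconfiguration.p-sub C (λ {a} {b} → ι-inj a b) (λ {R} {S} → g-inj R S) (col D) g-col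
    (λ aw≡ → ι-range _ (colour-avoids aw≡))

module TwoPointFiber {n r} (C : CC n r) (n>2 : n > 2) (indecomposable : Indecomposable C)
  (x₀ : Fin n) (|X|≡2 : fiberSize C x₀ ≡ 2) where
  open Configuration C public
  c = col C

  X : Fin n → Set
  X z = SameFiber C z x₀

  X? : Decidable X
  X? z = c z z ≟ c x₀ x₀

  opaque
    x : Fin 2 → Fin n
    x i = enumerate X? (cast (sym |X|≡2) i)

    x-injective : Injective _≡_ _≡_ x
    x-injective {i} {j} xi≡xj = trans (sym (cast-involutive |X|≡2 (sym |X|≡2) i))
      (trans (cong (cast |X|≡2) (enumerate-injective X? xi≡xj)) (cast-involutive |X|≡2 (sym |X|≡2) j))

    x∈X : ∀ i → X (x i)
    x∈X i = enumerate-sound X? (cast (sym |X|≡2) i)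

    x-complete : ∀ {z} → X z → ∃ λ i → x i ≡ z
    x-complete Xz with enumerate-complete X? Xz
    ... | k , refl = cast |X|≡2 k , cong (enumerate X?) (cast-involutive (sym |X|≡2) |X|≡2 k)

  ∃outside : ∃ λ z → ¬ X z
  ∃outside = ¬∀⟶∃¬ n X X? λ all-X → <-irrefl (trans (sym |X|≡2) (number-all X? all-X)) n>2

  i≢j⇒k≡i⊎k≡j : ∀ {i j : Fin 2} → i ≢ j → ∀ k → k ≡ i ⊎ k ≡ j
  i≢j⇒k≡i⊎k≡j {0F} {0F} i≢j _ = contradiction refl i≢j
  i≢j⇒k≡i⊎k≡j {1F} {1F} i≢j _ = contradiction refl i≢j
  i≢j⇒k≡i⊎k≡j {0F} {1F} _ 0F = inj₁ refl
  i≢j⇒k≡i⊎k≡j {0F} {1F} _ 1F = inj₂ refl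
  i≢j⇒k≡i⊎k≡j {1F} {0F} _ 0F = inj₂ refl
  i≢j⇒k≡i⊎k≡j {1F} {0F} _ 1F = inj₁ refl

  -- x 0 and x 1 witness p(z, z; c z (x 0), c (x 0) z) ≥ 2; by coherence z′ has two witnesses too, necessarily x 0 and x 1.
  alike-propagates : ∀ {z z′} → c (x 0F) z ≡ c (x 1F) z → SameFiber C z z′ → ∀ i → c (x i) z′ ≡ c (x 0F) z
  alike-propagates {z} {z′} alike zz′ k with 2≤number⇒distinct (witness? z′) (subst (2 ≤_) (coh C _ _ z z z′ z′ zz′) 2≤p)
    where
    witness? : ∀ t → Decidable λ w → c t w ≡ c z (x 0F) × c w t ≡ c (x 0F) z
    witness? t w = (c t w ≟ c z (x 0F)) ×-dec (c w t ≟ c (x 0F) z)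
    2≤p : 2 ≤ number (witness? z)
    2≤p = distinct⇒2≤number (witness? z) (λ x0≡x1 → contradiction (x-injective x0≡x1) λ ())
      (refl , refl) (transp C (x 1F) z (x 0F) z (sym alike) , sym alike)
  ... | w₁ , w₂ , w₁≢w₂ , (_ , w₁z′) , (_ , w₂z′)
    with x-complete (trans (source-fiber w₁z′) (x∈X 0F)) | x-complete (trans (source-fiber w₂z′) (x∈X 0F))
  ... | i₁ , refl | i₂ , refl with i≢j⇒k≡i⊎k≡j (λ i₁≡i₂ → w₁≢w₂ (cong x i₁≡i₂)) k
  ... | inj₁ refl = w₁z′
  ... | inj₂ refl = w₂z′

  ∃separating : ∃ λ y → ¬ X y × c (x 0F) y ≢ c (x 1F) y
  ∃separating with ¬∀⟶∃¬ n _ (λ z → X? z ⊎-dec (c (x 0F) z ≟ c (x 1F) z)) not-all-alike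
    where
    not-all-alike : ¬ (∀ z → X z ⊎ c (x 0F) z ≡ c (x 1F) z)
    not-all-alike all = indecomposable (does ∘ X?) (λ u v uv → cong (λ t → does (t ≟ c x₀ x₀)) uv)
      (x 0F , proj₁ ∃outside , parts-differ) uniform
      where
      parts-differ : does (X? (x 0F)) ≢ does (X? (proj₁ ∃outside))
      parts-differ P≡ = contradiction (trans (sym (dec-true (X? _) (x∈X 0F))) (trans P≡ (dec-false (X? _) (proj₂ ∃outside)))) λ ()
      alike : ∀ {v} → ¬ X v → c (x 0F) v ≡ c (x 1F) v
      alike ¬Xv with all _
      ... | inj₁ Xv = contradiction Xv ¬Xv
      ... | inj₂ alike-v = alike-v
      into-X : ∀ {u v u′ v′} → X u → ¬ X v → SameFiber C u u′ → SameFiber C v v′ → c u v ≡ c u′ v′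
      into-X Xu ¬Xv uu′ vv′ with x-complete Xu | x-complete (trans (sym uu′) Xu)
      ... | i , refl | j , refl = trans (alike-propagates (alike ¬Xv) refl i) (sym (alike-propagates (alike ¬Xv) vv′ j))
      uniform : ∀ u v u′ v′ → does (X? u) ≢ does (X? v) → SameFiber C u u′ → SameFiber C v v′ → c u v ≡ c u′ v′
      uniform u v u′ v′ P≢ uu′ vv′ with X? u | X? v
      ... | yes _ | yes _ = contradiction refl P≢
      ... | no _ | no _ = contradiction refl P≢
      ... | yes Xu | no ¬Xv = into-X Xu ¬Xv uu′ vv′
      ... | no ¬Xu | yes Xv = transp C v u v′ u′ (into-X Xv ¬Xu vv′ uu′)
  ... | y , ¬X⊎alike = y , ¬X⊎alike ∘ inj₁ , ¬X⊎alike ∘ inj₂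

  opaque
    y : Fin n
    y = proj₁ ∃separating

    y∉X : ¬ X y
    y∉X = proj₁ (proj₂ ∃separating)

    y-separates : ∀ {i j} → c (x i) y ≡ c (x j) y → i ≡ j
    y-separates {0F} {0F} _ = refl
    y-separates {1F} {1F} _ = refl
    y-separates {0F} {1F} eq = contradiction eq (proj₂ (proj₂ ∃separating))
    y-separates {1F} {0F} eq = contradiction (sym eq) (proj₂ (proj₂ ∃separating))

  x-sole-predecessor : ∀ i → SolePredecessor y (x i)
  x-sole-predecessor i wy≡ with x-complete (trans (source-fiber wy≡) (x∈X i))
  ... | j , refl = cong x (y-separates wy≡)

  x-sole-successor : ∀ i → SoleSuccessor y (x i)
  x-sole-successor i {w} yw≡ = x-sole-predecessor i (transp C y w y (x i) yw≡)

  X-sole-successor : ∀ i k → SoleSuccessor (x i) (x k)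
  X-sole-successor i k {w} ≡ik with x-complete (trans (target-fiber ≡ik) (x∈X k))
  ... | l , refl with l ≟ k
  ... | yes refl = refl
  ... | no l≢k with i≢j⇒k≡i⊎k≡j l≢k i
  ... | inj₁ refl = loops C (x l) (x l) (x k) (sym ≡ik)
  ... | inj₂ refl = sym (loops C (x k) (x k) (x l) ≡ik)

  opaque
    π : ∀ {z} → SameFiber C z y → Fin 2 → Fin n
    π zy i = proj₁ (out-neighbour {t = x i} zy)

    π-colour : ∀ {z} (zy : SameFiber C z y) i → c z (π zy i) ≡ c y (x i)
    π-colour zy i = proj₂ (out-neighbour {t = x i} zy)

  π-sole : ∀ {z} (zy : SameFiber C z y) i → SoleSuccessor z (π zy i)
  π-sole {z} zy i {t} zt≡ = number≡1⇒≡ witness? (trans (coh C (c y (x i)) (c (x i) y) z z y y zy) (sole⇒p≡1 (x-sole-successor i)))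
    (trans zt≡ (π-colour zy i) , transp C z t y (x i) (trans zt≡ (π-colour zy i)))
    (π-colour zy i , transp C z _ y (x i) (π-colour zy i))
    where
    witness? : Decidable λ w → c z w ≡ c y (x i) × c w z ≡ c (x i) y
    witness? w = (c z w ≟ c y (x i)) ×-dec (c w z ≟ c (x i) y)

  π-y : ∀ i → π {y} refl i ≡ x i
  π-y i = x-sole-successor i (π-colour {y} refl i)

  π-row : ∀ {z v v′} (zy : SameFiber C z y) i → c z v ≡ c y v′ → c (π zy i) v ≡ c (x i) v′
  π-row zy i zv≡ with triangle-transfer {w = x i} (sym zv≡) refl refl
  ... | t , zt , tv with π-sole zy i (trans zt (sym (π-colour zy i)))
  ... | refl = tv

  π-column : ∀ {z u u′} (zy : SameFiber C z y) i → c u z ≡ c u′ y → c u (π zy i) ≡ c u′ (x i)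
  π-column {z} zy i uz≡ with triangle-transfer {w = x i} (sym uz≡) refl refl
  ... | t , ut , tz with π-sole zy i (trans (transp C t z (x i) y tz) (sym (π-colour zy i)))
  ... | refl = ut

  π-permutes : ∀ {z} (zy : SameFiber C z y) {P : Pred (Fin n) 0ℓ} (P? : Decidable P) → number (P? ∘ π zy) ≡ number (P? ∘ x)
  π-permutes {z} zy P? = trans (number≡∑ (P? ∘ π zy)) (trans (∑-permutes (λ w → [ P? w ])) (sym (number≡∑ (P? ∘ x))))
    where
    ∑-permutes : (h : Fin n → ℕ) → ∑[ i < 2 ] h (π zy i) ≡ ∑[ i < 2 ] h (x i)
    ∑-permutes h with x-complete (π∈X 0F) | x-complete (π∈X 1F)
      where
      π∈X : ∀ i → X (π zy i)
      π∈X i = trans (target-fiber (π-colour zy i)) (x∈X i)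
    ... | j₀ , xj₀≡π₀ | j₁ , xj₁≡π₁ =
      trans (cong₂ (λ a b → h a + (h b + 0)) (sym xj₀≡π₀) (sym xj₁≡π₁)) (swap j₀ j₁ j₀≢j₁)
      where
      j₀≢j₁ : j₀ ≢ j₁
      j₀≢j₁ refl = contradiction
        (x-sole-successor 1F (trans (sym (π-colour zy 0F)) (trans (cong (c z) (trans (sym xj₀≡π₀) xj₁≡π₁)) (π-colour zy 1F))))
        (λ x0≡x1 → contradiction (x-injective x0≡x1) λ ())
      swap : ∀ k₀ k₁ → k₀ ≢ k₁ → h (x k₀) + (h (x k₁) + 0) ≡ h (x 0F) + (h (x 1F) + 0)
      swap 0F 0F k₀≢k₁ = contradiction refl k₀≢k₁
      swap 1F 1F k₀≢k₁ = contradiction refl k₀≢k₁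
      swap 0F 1F _ = refl
      swap 1F 0F _ = trans (cong (h (x 1F) +_) (+-identityʳ _)) (trans (+-comm (h (x 1F)) (h (x 0F))) (cong (h (x 0F) +_) (sym (+-identityʳ _))))

  opaque
    -- Junk value T when T is not the colour of a pair leaving y.
    row-shift : Fin 2 → Fin r → Fin r
    row-shift i T with any? (λ v → c y v ≟ T)
    ... | yes (v , _) = c (x i) v
    ... | no _ = T

    row-shift-through : ∀ {z} (zy : SameFiber C z y) i v → row-shift i (c z v) ≡ c (π zy i) v
    row-shift-through {z} zy i v with any? (λ v′ → c y v′ ≟ c z v)
    ... | yes (v′ , yv′≡) = sym (π-row zy i (sym yv′≡))
    ... | no none = contradiction (out-neighbour (sym zy)) none

  row-shift-y : ∀ i v → row-shift i (c y v) ≡ c (x i) v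
  row-shift-y i v = trans (row-shift-through {y} refl i v) (cong (λ t → c t v) (π-y i))

  opaque
    -- Junk value T when T is not the colour of a pair entering y.
    column-shift : Fin 2 → Fin r → Fin r
    column-shift i T with any? (λ u → c u y ≟ T)
    ... | yes (u , _) = c u (x i)
    ... | no _ = T

    column-shift-through : ∀ {z} (zy : SameFiber C z y) i u → column-shift i (c u z) ≡ c u (π zy i)
    column-shift-through {z} zy i u with any? (λ u′ → c u′ y ≟ c u z)
    ... | yes (u′ , u′y≡) = sym (π-column zy i (sym u′y≡))
    ... | no none = contradiction (in-neighbour (sym zy)) none

  column-shift-y : ∀ i u → column-shift i (c u y) ≡ c u (x i)
  column-shift-y i u = trans (column-shift-through {y} refl i u) (cong (c u) (π-y i))

module TwoPointRemoval {n r} (C : CC n r) (n>2 : n > 2) (indecomposable : Indecomposable C)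
  (x₀ : Fin n) (|X|≡2 : fiberSize C x₀ ≡ 2) {m s} {D : CC m s} (removal : IsRemoval C x₀ D) where
  open TwoPointFiber C n>2 indecomposable x₀ |X|≡2 public
  open IsRemoval removal public
  open Removal removal public

  Origin : Fin n → Set
  Origin z = (∃ λ i → x i ≡ z) ⊎ (∃ λ a → ι a ≡ z)

  X-cover : DisjointCover x ι
  X-cover = record
    { e-injective = x-injective
    ; ι-injective = λ {a} {b} → ι-inj a b
    ; disjoint = λ i a xi≡ιa → ι-avoid a (subst X xi≡ιa (x∈X i))
    ; cover = λ z → cover z (X? z)
    }
    where
    cover : ∀ z → Dec (X z) → Origin z
    cover z (yes Xz) = inj₁ (x-complete Xz)
    cover z (no ¬Xz) = inj₂ (ι-range z ¬Xz)

  ỹ : Fin m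
  ỹ = proj₁ (ι-range y y∉X)

  ιỹ≡y : ι ỹ ≡ y
  ιỹ≡y = proj₂ (ι-range y y∉X)

  ỹ-successor : ∀ i → SoleSuccessor (ι ỹ) (x i)
  ỹ-successor i = subst (λ t → SoleSuccessor t (x i)) (sym ιỹ≡y) (x-sole-successor i)

  ỹ-predecessor : ∀ i → SolePredecessor (ι ỹ) (x i)
  ỹ-predecessor i = subst (λ t → SolePredecessor t (x i)) (sym ιỹ≡y) (x-sole-predecessor i)

module ExtendFromRemoval {n r} (C : CC n r) (n>2 : n > 2) (indecomposable : Indecomposable C)
  (x₀ : Fin n) (|X|≡2 : fiberSize C x₀ ≡ 2) {m s} {D : CC m s} (removal : IsRemoval C x₀ D)
  (D-separable : Separable D) {n′ r′} {C′ : CC n′ r′} (a : AlgIso C C′) where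
  open TwoPointRemoval C n>2 indecomposable x₀ |X|≡2 removal
  open AlgebraicIsomorphism a
  private
    c′ = col C′

  X′ : Fin n′ → Set
  X′ w = c′ w w ≡ to (c x₀ x₀)

  X′? : Decidable X′
  X′? w = c′ w w ≟ to (c x₀ x₀)

  X′⇒X : ∀ {u u′} → c′ u′ u′ ≡ to (c u u) → X′ u′ → X u
  X′⇒X uu′ X′u′ = to-injective (trans (sym uu′) X′u′)

  g-endpoints : ∀ {u′ v′ R} → c′ u′ v′ ≡ to (g R) → ¬ X′ u′ × ¬ X′ v′
  g-endpoints {R = R} uv′ with nonempty D R
  ... | a₁ , b₁ , refl = (ι-avoid a₁ ∘ X′⇒X (source-fiber-to uv))
                       , (ι-avoid b₁ ∘ X′⇒X (target-fiber-to uv))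
    where uv = trans uv′ (cong to (sym (g-col a₁ b₁)))

  colour-outside : ∀ {w z} → ¬ X′ w → ¬ X′ z → ∃ λ R → c′ w z ≡ to (g R)
  colour-outside {w} {z} ¬X′w ¬X′z with ∃pair-from w z
  ... | u , v , wz with ι-range u (¬X′w ∘ X⇒X′ (source-fiber-to wz)) | ι-range v (¬X′z ∘ X⇒X′ (target-fiber-to wz))
    where
    X⇒X′ : ∀ {t t′} → c′ t′ t′ ≡ to (c t t) → X t → X′ t′
    X⇒X′ tt′ Xt = trans tt′ (cong to Xt)
  ... | a₁ , refl | b₁ , refl = col D a₁ b₁ , trans wz (cong to (g-col a₁ b₁))

  m′ : ℕ
  m′ = number (¬? ∘ X′?)

  ι′ : Fin m′ → Fin n′
  ι′ = enumerate (¬? ∘ X′?)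

  opaque
    colD′ : Fin m′ → Fin m′ → Fin s
    colD′ j k = proj₁ (colour-outside (enumerate-sound (¬? ∘ X′?) j) (enumerate-sound (¬? ∘ X′?) k))

    col-ι′ : ∀ j k → c′ (ι′ j) (ι′ k) ≡ to (g (colD′ j k))
    col-ι′ j k = proj₂ (colour-outside (enumerate-sound (¬? ∘ X′?) j) (enumerate-sound (¬? ∘ X′?) k))

  closed′ : ∀ {j w R} → c′ (ι′ j) w ≡ to (g R) → ∃ λ k → ι′ k ≡ w
  closed′ jw = enumerate-complete (¬? ∘ X′?) (proj₂ (g-endpoints jw))

  private
    module C′∖X′ = Subconfiguration C′ (enumerate-injective (¬? ∘ X′?)) (λ {R} {S} → g-inj R S ∘ to-injective)
      colD′ col-ι′ closed′

  D′ : CC m′ s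
  D′ = C′∖X′.subconfiguration nonempty′
    where
    nonempty′ : ∀ R → ∃ λ j → ∃ λ k → colD′ j k ≡ R
    nonempty′ R with nonempty C′ (to (g R))
    ... | u′ , v′ , uv′ with g-endpoints uv′
    ... | ¬X′u′ , ¬X′v′ with enumerate-complete (¬? ∘ X′?) ¬X′u′ | enumerate-complete (¬? ∘ X′?) ¬X′v′
    ... | j , refl | k , refl = j , k , g-inj (colD′ j k) R (to-injective {g (colD′ j k)} {g R} (trans (sym (col-ι′ j k)) uv′))

  D≅D′ : AlgIso D D′
  D≅D′ = record
    { f = ⤖-id (Fin s)
    ; pres = λ R S a₁ b₁ j k jk≡ → trans (p-removal a₁ b₁ R S)
        (trans (pres a (g R) (g S) (ι a₁) (ι b₁) (ι′ j) (ι′ k)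
                 (trans (col-ι′ j k) (cong to (trans (cong g jk≡) (sym (g-col a₁ b₁))))))
          (sym (C′∖X′.p-sub j k R S)))
    }

  opaque
    Ψ : Fin m → Fin n′
    Ψ = ι′ ∘ Bijection.to (proj₁ (D-separable m′ s D′ D≅D′))

    Ψ-colour : ∀ a₁ b₁ → c′ (Ψ a₁) (Ψ b₁) ≡ to (c (ι a₁) (ι b₁))
    Ψ-colour a₁ b₁ =
      trans (col-ι′ _ _) (cong to (trans (cong g (proj₂ (D-separable m′ s D′ D≅D′) a₁ b₁)) (sym (g-col a₁ b₁))))

    Ψ-onto : ∀ j → ∃ λ b → Ψ b ≡ ι′ j
    Ψ-onto j with Bijection.surjective (proj₁ (D-separable m′ s D′ D≅D′)) j
    ... | b , ψb≡j = b , cong ι′ (ψb≡j refl)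

  opaque
    x′ : Fin 2 → Fin n′
    x′ i = proj₁ (triangle-to {w = x i} (Ψ-colour ỹ ỹ) refl refl)

    x′-in : ∀ i → c′ (Ψ ỹ) (x′ i) ≡ to (c (ι ỹ) (x i))
    x′-in i = proj₁ (proj₂ (triangle-to {w = x i} (Ψ-colour ỹ ỹ) refl refl))

    x′-out : ∀ i → c′ (x′ i) (Ψ ỹ) ≡ to (c (x i) (ι ỹ))
    x′-out i = proj₂ (proj₂ (triangle-to {w = x i} (Ψ-colour ỹ ỹ) refl refl))

  x′-colour : ∀ i j → c′ (x′ i) (x′ j) ≡ to (c (x i) (x j))
  x′-colour i j = via-sole-successor (ỹ-successor i) (x′-in j) (x′-in i)

  x′Ψ-colour : ∀ i b → c′ (x′ i) (Ψ b) ≡ to (c (x i) (ι b))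
  x′Ψ-colour i b = via-sole-successor (ỹ-successor i) (Ψ-colour ỹ b) (x′-in i)

  Ψx′-colour : ∀ b i → c′ (Ψ b) (x′ i) ≡ to (c (ι b) (x i))
  Ψx′-colour b i = via-sole-predecessor (ỹ-predecessor i) (Ψ-colour b ỹ) (x′-out i)

  image-of : ∀ {z} → Origin z → Fin n′
  image-of (inj₁ (i , _)) = x′ i
  image-of (inj₂ (b , _)) = Ψ b

  image-colour : ∀ {u v} (u-origin : Origin u) (v-origin : Origin v) → c′ (image-of u-origin) (image-of v-origin) ≡ to (c u v)
  image-colour (inj₁ (i , refl)) (inj₁ (j , refl)) = x′-colour i j
  image-colour (inj₁ (i , refl)) (inj₂ (b , refl)) = x′Ψ-colour i b
  image-colour (inj₂ (a₁ , refl)) (inj₁ (j , refl)) = Ψx′-colour a₁ j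
  image-colour (inj₂ (a₁ , refl)) (inj₂ (b , refl)) = Ψ-colour a₁ b

  φ : Fin n → Fin n′
  φ z = image-of (DisjointCover.cover X-cover z)

  φ-colour : ∀ u v → c′ (φ u) (φ v) ≡ to (c u v)
  φ-colour u v = image-colour (DisjointCover.cover X-cover u) (DisjointCover.cover X-cover v)

  φ-injective : Injective _≡_ _≡_ φ
  φ-injective {u} {v} φu≡φv =
    loops C u u v (to-injective (trans (sym (φ-colour u v)) (trans (cong (c′ (φ u)) (sym φu≡φv)) (φ-colour u u))))

  image-x : ∀ i (origin : Origin (x i)) → image-of origin ≡ x′ i
  image-x i (inj₁ (j , xj≡xi)) = cong x′ (x-injective xj≡xi)
  image-x i (inj₂ (b , ιb≡xi)) = contradiction (sym ιb≡xi) (DisjointCover.disjoint X-cover i b)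

  image-ι : ∀ b (origin : Origin (ι b)) → image-of origin ≡ Ψ b
  image-ι b (inj₁ (i , xi≡ιb)) = contradiction xi≡ιb (DisjointCover.disjoint X-cover i b)
  image-ι b (inj₂ (a₁ , ιa≡ιb)) = cong Ψ (ι-inj a₁ b ιa≡ιb)

  φ-x : ∀ i → φ (x i) ≡ x′ i
  φ-x i = image-x i (DisjointCover.cover X-cover (x i))

  φ-ι : ∀ b → φ (ι b) ≡ Ψ b
  φ-ι b = image-ι b (DisjointCover.cover X-cover (ι b))

  onto-X′ : ∀ {v′} → X′ v′ → ∃ λ z → φ z ≡ v′
  onto-X′ {v′} X′v′ with ∃pair-from (x′ 0F) v′
  ... | u , w , x0v′ = reach {u} {w} x0v′
    where
    reach : ∀ {u w} → c′ (x′ 0F) v′ ≡ to (c u w) → ∃ λ z → φ z ≡ v′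
    reach {u} {w} x0v′
      with out-neighbour {x 0F} {u} {w} (to-injective {c (x 0F) (x 0F)} {c u u} (trans (sym (x′-colour 0F 0F)) (source-fiber-to x0v′)))
    ... | b , x0b≡uw with x-complete (trans (target-fiber x0b≡uw) (X′⇒X (target-fiber-to x0v′) X′v′))
    ... | k , refl = x k , trans (φ-x k)
      (sole-successor-to (X-sole-successor 0F k) (x′-colour 0F 0F) (x′-colour 0F k) (trans x0v′ (cong to (sym x0b≡uw))))

  φ-surjective : ∀ v′ → ∃ λ z → φ z ≡ v′
  φ-surjective v′ with X′? v′
  ... | yes X′v′ = onto-X′ X′v′
  ... | no ¬X′v′ with enumerate-complete (¬? ∘ X′?) ¬X′v′
  ... | j , refl with Ψ-onto j
  ... | b , Ψb≡ = ι b , trans (φ-ι b) Ψb≡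

  induced : Induced a
  induced = mk⤖′ φ φ-injective φ-surjective , φ-colour

module RestrictToRemoval {n r} (C : CC n r) (n>2 : n > 2) (indecomposable : Indecomposable C)
  (x₀ : Fin n) (|X|≡2 : fiberSize C x₀ ≡ 2) {m s} {D : CC m s} (removal : IsRemoval C x₀ D)
  (C-separable : Separable C) {m′ s′} {D′ : CC m′ s′} (b : AlgIso D D′) where
  open TwoPointRemoval C n>2 indecomposable x₀ |X|≡2 removal
  private
    module B = AlgebraicIsomorphism b
    d = col D
    d′ = col D′

  ỹ-row : ∀ i w → row-shift i (g (d ỹ w)) ≡ c (x i) (ι w)
  ỹ-row i w = trans (cong (row-shift i) (trans (sym (g-col ỹ w)) (cong (λ t → c t (ι w)) ιỹ≡y))) (row-shift-y i (ι w))

  ỹ-column : ∀ i w → column-shift i (g (d w ỹ)) ≡ c (ι w) (x i)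
  ỹ-column i w = trans (cong (column-shift i) (trans (sym (g-col w ỹ)) (cong (c (ι w)) ιỹ≡y))) (column-shift-y i (ι w))

  opaque
    y′ : Fin m′
    y′ = proj₁ (nonempty D′ (B.to (d ỹ ỹ)))

    y′-loop : d′ y′ y′ ≡ B.to (d ỹ ỹ)
    y′-loop = trans (cong (d′ y′) (B.loop-to {ỹ} loop)) loop
      where
      loop : d′ y′ (proj₁ (proj₂ (nonempty D′ (B.to (d ỹ ỹ))))) ≡ B.to (d ỹ ỹ)
      loop = proj₂ (proj₂ (nonempty D′ (B.to (d ỹ ỹ))))

  -- C″ has the points of X (inj₁) and of D′ (inj₂); colours at the points of X are read off through y′.
  Point″ : Set
  Point″ = Fin 2 ⊎ Fin m′

  rep : Point″ → Fin m′
  rep (inj₁ _) = y′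
  rep (inj₂ u′) = u′

  row-of : Point″ → Fin s → Fin r
  row-of (inj₁ i) = row-shift i ∘ g
  row-of (inj₂ _) = g

  column-of : Point″ → Fin s → Fin r
  column-of (inj₁ j) = column-shift j ∘ g
  column-of (inj₂ _) = g

  colour″ : Point″ → Point″ → Fin r
  colour″ (inj₁ i) (inj₁ j) = c (x i) (x j)
  colour″ (inj₁ i) (inj₂ v′) = row-shift i (g (B.from (d′ y′ v′)))
  colour″ (inj₂ u′) (inj₁ j) = column-shift j (g (B.from (d′ u′ y′)))
  colour″ (inj₂ u′) (inj₂ v′) = g (B.from (d′ u′ v′))

  colour″-row : ∀ k w → colour″ k (inj₂ w) ≡ row-of k (B.from (d′ (rep k) w))
  colour″-row (inj₁ _) _ = refl
  colour″-row (inj₂ _) _ = refl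

  colour″-column : ∀ w l → colour″ (inj₂ w) l ≡ column-of l (B.from (d′ w (rep l)))
  colour″-column _ (inj₁ _) = refl
  colour″-column _ (inj₂ _) = refl

  N : ℕ
  N = 2 + m′

  col″ : Fin N → Fin N → Fin r
  col″ u″ v″ = colour″ (splitAt 2 u″) (splitAt 2 v″)

  col″-join : ∀ k l → col″ (join 2 m′ k) (join 2 m′ l) ≡ colour″ k l
  col″-join k l = cong₂ colour″ (splitAt-join 2 m′ k) (splitAt-join 2 m′ l)

  new-old-cover : DisjointCover (_↑ˡ m′) (2 ↑ʳ_)
  new-old-cover = record
    { e-injective = ↑ˡ-injective m′ _ _
    ; ι-injective = ↑ʳ-injective 2 _ _
    ; disjoint = λ i w eq → contradiction (trans (sym (splitAt-↑ˡ 2 i m′)) (trans (cong (splitAt 2) eq) (splitAt-↑ʳ 2 m′ w))) λ ()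
    ; cover = λ z → cover z (splitAt 2 z) (join-splitAt 2 m′ z)
    }
    where
    cover : ∀ z (k : Point″) → join 2 m′ k ≡ z → (∃ λ i → i ↑ˡ m′ ≡ z) ⊎ (∃ λ w → 2 ↑ʳ w ≡ z)
    cover z (inj₁ i) eq = inj₁ (i , eq)
    cover z (inj₂ w) eq = inj₂ (w , eq)

  p-split : ∀ u v R S → p c u v R S ≡
    number (λ i → c u (x i) ≟ R ×-dec c (x i) v ≟ S) + number (λ w → c u (ι w) ≟ R ×-dec c (ι w) v ≟ S)
  p-split u v R S = number-cover X-cover (λ w → c u w ≟ R ×-dec c w v ≟ S)

  p″-split : ∀ k l R S → p col″ (join 2 m′ k) (join 2 m′ l) R S ≡
    number (λ i → colour″ k (inj₁ i) ≟ R ×-dec colour″ (inj₁ i) l ≟ S) +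
    number (λ w → colour″ k (inj₂ w) ≟ R ×-dec colour″ (inj₂ w) l ≟ S)
  p″-split k l R S = trans (number-cover new-old-cover (λ w → col″ (join 2 m′ k) w ≟ R ×-dec col″ w (join 2 m′ l) ≟ S))
    (cong₂ _+_ (number-≟-cong (λ i → col″-join k (inj₁ i)) (λ i → col″-join (inj₁ i) l) R S)
               (number-≟-cong (λ w → col″-join k (inj₂ w)) (λ w → col″-join (inj₂ w) l) R S))

  record Match (k l : Point″) : Set where
    field
      u v : Fin n
      a₁ b₁ : Fin m
      row : ∀ w → c u (ι w) ≡ row-of k (d a₁ w)
      column : ∀ w → c (ι w) v ≡ column-of l (d w b₁)
      reps : d′ (rep k) (rep l) ≡ B.to (d a₁ b₁)
      X-part : ∀ R S → number (λ i → c u (x i) ≟ R ×-dec c (x i) v ≟ S) ≡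
                       number (λ i → colour″ k (inj₁ i) ≟ R ×-dec colour″ (inj₁ i) l ≟ S)
      colour : c u v ≡ colour″ k l
      colourᵀ : c v u ≡ colour″ l k
      loop⇒ : u ≡ v → k ≡ l
      loop⇐ : k ≡ l → u ≡ v

  match⇒mimic : ∀ {k l} → Match k l → Mimic C col″ (join 2 m′ k) (join 2 m′ l)
  match⇒mimic {k} {l} M = record
    { u = u
    ; v = v
    ; colour = trans colour (sym (col″-join k l))
    ; colourᵀ = trans colourᵀ (sym (col″-join l k))
    ; loop⇒ = cong (join 2 m′) ∘ loop⇒
    ; loop⇐ = loop⇐ ∘ join-injective
    ; p-eq = λ R S → trans (p-split u v R S) (trans (cong₂ _+_ (X-part R S) (D-part R S)) (sym (p″-split k l R S)))
    }
    where
    open Match M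
    join-injective : join 2 m′ k ≡ join 2 m′ l → k ≡ l
    join-injective eq = trans (sym (splitAt-join 2 m′ k)) (trans (cong (splitAt 2) eq) (splitAt-join 2 m′ l))
    D-part : ∀ R S → number (λ w → c u (ι w) ≟ R ×-dec c (ι w) v ≟ S) ≡
                     number (λ w → colour″ k (inj₂ w) ≟ R ×-dec colour″ (inj₂ w) l ≟ S)
    D-part R S = trans (number-≟-cong row column R S)
      (trans (B.count-to reps (λ P Q → row-of k P ≟ R ×-dec column-of l Q ≟ S))
        (sym (number-≟-cong (colour″-row k) (λ w → colour″-column w l) R S)))

  match-new-new : ∀ i j → Match (inj₁ i) (inj₁ j)
  match-new-new i j = record
    { u = x i ; v = x j ; a₁ = ỹ ; b₁ = ỹ
    ; row = λ w → sym (ỹ-row i w)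
    ; column = λ w → sym (ỹ-column j w)
    ; reps = y′-loop
    ; X-part = λ _ _ → refl
    ; colour = refl
    ; colourᵀ = refl
    ; loop⇒ = cong inj₁ ∘ x-injective
    ; loop⇐ = λ { refl → refl }
    }

  match-new-old : ∀ i {v′ b₁} → d′ y′ v′ ≡ B.to (d ỹ b₁) → Match (inj₁ i) (inj₂ v′)
  match-new-old i {v′} {b₁} reps = record
    { u = x i ; v = ι b₁ ; a₁ = ỹ ; b₁ = b₁
    ; row = λ w → sym (ỹ-row i w)
    ; column = λ w → g-col w b₁
    ; reps = reps
    ; X-part = number-≟-cong {f = λ j → c (x i) (x j)} (λ _ → refl) into-b₁
    ; colour = into-b₁ i
    ; colourᵀ = trans (sym (ỹ-column i b₁)) (cong (column-shift i ∘ g) (sym (B.from-colour (B.transpose-to reps))))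
    ; loop⇒ = λ xi≡ιb → contradiction xi≡ιb (DisjointCover.disjoint X-cover i b₁)
    ; loop⇐ = λ ()
    }
    where
    into-b₁ : ∀ j → c (x j) (ι b₁) ≡ row-shift j (g (B.from (d′ y′ v′)))
    into-b₁ j = trans (sym (ỹ-row j b₁)) (cong (row-shift j ∘ g) (sym (B.from-colour reps)))

  match-old-new : ∀ j {u′ a₁} → d′ u′ y′ ≡ B.to (d a₁ ỹ) → Match (inj₂ u′) (inj₁ j)
  match-old-new j {u′} {a₁} reps = record
    { u = ι a₁ ; v = x j ; a₁ = a₁ ; b₁ = ỹ
    ; row = g-col a₁
    ; column = λ w → sym (ỹ-column j w)
    ; reps = reps
    ; X-part = number-≟-cong {h = λ i → c (x i) (x j)} out-of-a₁ (λ _ → refl)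
    ; colour = out-of-a₁ j
    ; colourᵀ = trans (sym (ỹ-row j a₁)) (cong (row-shift j ∘ g) (sym (B.from-colour (B.transpose-to reps))))
    ; loop⇒ = λ ιa≡xj → contradiction (sym ιa≡xj) (DisjointCover.disjoint X-cover j a₁)
    ; loop⇐ = λ ()
    }
    where
    out-of-a₁ : ∀ i → c (ι a₁) (x i) ≡ column-shift i (g (B.from (d′ u′ y′)))
    out-of-a₁ i = trans (sym (ỹ-column i a₁)) (cong (column-shift i ∘ g) (sym (B.from-colour reps)))

  -- A point t of D realising the triangle u′ → y′ → v′ of D′ lies in the fibre of ỹ, and the X-part is counted through ι t.
  match-old-old : ∀ {u′ v′ a₁ b₁} → d′ u′ v′ ≡ B.to (d a₁ b₁) → Match (inj₂ u′) (inj₂ v′)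
  match-old-old {u′} {v′} {a₁} {b₁} reps = record
    { u = ι a₁ ; v = ι b₁ ; a₁ = a₁ ; b₁ = b₁
    ; row = g-col a₁
    ; column = λ w → g-col w b₁
    ; reps = reps
    ; X-part = X-part
    ; colour = trans (g-col a₁ b₁) (cong g (sym (B.from-colour reps)))
    ; colourᵀ = trans (g-col b₁ a₁) (cong g (sym (B.from-colour (B.transpose-to reps))))
    ; loop⇒ = λ ιa≡ιb → cong inj₂ (B.loop-to {a₁} (trans reps (cong (B.to ∘ d a₁) (sym (ι-inj a₁ b₁ ιa≡ιb)))))
    ; loop⇐ = λ { refl → cong ι (loops D a₁ a₁ b₁ (B.to-injective (trans (sym reps) (B.source-fiber-to reps)))) }
    }
    where
    X-part : ∀ R S → number (λ i → c (ι a₁) (x i) ≟ R ×-dec c (x i) (ι b₁) ≟ S) ≡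
                     number (λ i → colour″ (inj₂ u′) (inj₁ i) ≟ R ×-dec colour″ (inj₁ i) (inj₂ v′) ≟ S)
    X-part R S
      with B.triangle-from {R = B.from (d′ u′ y′)} {S = B.from (d′ y′ v′)} {w′ = y′}
             reps (sym (B.to-from (d′ u′ y′))) (sym (B.to-from (d′ y′ v′)))
    ... | t , a₁t , tb₁ = trans (sym (π-permutes tỹ (λ w → c (ι a₁) w ≟ R ×-dec c w (ι b₁) ≟ S)))
      (number-≟-cong (λ i → trans (sym (column-shift-through tỹ i (ι a₁))) (cong (column-shift i) (trans (g-col a₁ t) (cong g a₁t))))
                     (λ i → trans (sym (row-shift-through tỹ i (ι b₁))) (cong (row-shift i) (trans (g-col t b₁) (cong g tb₁)))) R S)
      where
      tt≡ỹỹ : d t t ≡ d ỹ ỹ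
      tt≡ỹỹ = B.to-injective (trans (sym (B.target-fiber-to (trans (sym (B.to-from (d′ u′ y′))) (cong B.to (sym a₁t))))) y′-loop)
      tỹ : SameFiber C (ι t) y
      tỹ = trans (g-col t t) (trans (cong g tt≡ỹỹ) (trans (sym (g-col ỹ ỹ)) (cong (λ z → c z z) ιỹ≡y)))

  matches : ∀ k l → Match k l
  matches (inj₁ i) (inj₁ j) = match-new-new i j
  matches (inj₁ i) (inj₂ v′) = match-new-old i {v′} {proj₁ found} (proj₂ found)
    where
    found : ∃ λ b₁ → d′ y′ v′ ≡ B.to (d ỹ b₁)
    found = B.∃successor-from {ỹ} {y′} y′-loop v′
  matches (inj₂ u′) (inj₁ j) = match-old-new j {u′} {proj₁ found} (proj₂ found)
    where
    found : ∃ λ a₁ → d′ u′ y′ ≡ B.to (d a₁ ỹ)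
    found = B.∃predecessor-from {ỹ} {y′} y′-loop u′
  matches (inj₂ u′) (inj₂ v′) = match-old-old {u′} {v′} {proj₁ found} {proj₁ (proj₂ found)} (proj₂ (proj₂ found))
    where
    found : ∃ λ a₁ → ∃ λ b₁ → d′ u′ v′ ≡ B.to (d a₁ b₁)
    found = B.∃pair-from u′ v′

  onto″ : ∀ T → ∃ λ u″ → ∃ λ v″ → col″ u″ v″ ≡ T
  onto″ T = join 2 m′ (proj₁ realised) , join 2 m′ (proj₁ (proj₂ realised)) ,
    trans (col″-join (proj₁ realised) (proj₁ (proj₂ realised))) (trans (proj₂ (proj₂ realised)) (proj₂ (proj₂ (nonempty C T))))
    where
    realise : ∀ {u v} → Origin u → Origin v → ∃ λ k → ∃ λ l → colour″ k l ≡ c u v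
    realise (inj₁ (i , refl)) (inj₁ (j , refl)) = inj₁ i , inj₁ j , refl
    realise (inj₁ (i , refl)) (inj₂ (b₁ , refl)) = inj₁ i , inj₂ (proj₁ found) ,
      trans (cong (row-shift i ∘ g) (B.from-colour (proj₂ found))) (ỹ-row i b₁)
      where
      found : ∃ λ v′ → d′ y′ v′ ≡ B.to (d ỹ b₁)
      found = B.∃successor-to {ỹ} {y′} y′-loop b₁
    realise (inj₂ (a₁ , refl)) (inj₁ (j , refl)) = inj₂ (proj₁ found) , inj₁ j ,
      trans (cong (column-shift j ∘ g) (B.from-colour (proj₂ found))) (ỹ-column j a₁)
      where
      found : ∃ λ u′ → d′ u′ y′ ≡ B.to (d a₁ ỹ)
      found = B.∃predecessor-to {ỹ} {y′} y′-loop a₁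
    realise (inj₂ (a₁ , refl)) (inj₂ (b₁ , refl)) = inj₂ (proj₁ found) , inj₂ (proj₁ (proj₂ found)) ,
      trans (cong g (B.from-colour (proj₂ (proj₂ found)))) (sym (g-col a₁ b₁))
      where
      found : ∃ λ u′ → ∃ λ v′ → d′ u′ v′ ≡ B.to (d a₁ b₁)
      found = nonempty D′ (B.to (d a₁ b₁))
    realised : ∃ λ k → ∃ λ l → colour″ k l ≡ c (proj₁ (nonempty C T)) (proj₁ (proj₂ (nonempty C T)))
    realised = realise (DisjointCover.cover X-cover _) (DisjointCover.cover X-cover _)

  mimic : ∀ u″ v″ → Mimic C col″ u″ v″
  mimic u″ v″ = subst₂ (Mimic C col″) (join-splitAt 2 m′ u″) (join-splitAt 2 m′ v″)
    (match⇒mimic (matches (splitAt 2 u″) (splitAt 2 v″)))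

  open Mimicry C col″ mimic onto″ using (mimic-CC; mimic-iso)

  opaque
    φ : Fin n ⤖ Fin N
    φ = proj₁ (C-separable N r mimic-CC mimic-iso)

    φ-colour : ∀ u v → col″ (Bijection.to φ u) (Bijection.to φ v) ≡ c u v
    φ-colour = proj₂ (C-separable N r mimic-CC mimic-iso)

  old-point : ∀ a → ∃ λ w′ → 2 ↑ʳ w′ ≡ Bijection.to φ (ι a)
  old-point a = exclude-new (DisjointCover.cover new-old-cover (Bijection.to φ (ι a)))
    where
    exclude-new : (∃ λ i → i ↑ˡ m′ ≡ Bijection.to φ (ι a)) ⊎ (∃ λ w′ → 2 ↑ʳ w′ ≡ Bijection.to φ (ι a)) →
      ∃ λ w′ → 2 ↑ʳ w′ ≡ Bijection.to φ (ι a)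
    exclude-new (inj₂ old) = old
    exclude-new (inj₁ (i , new≡)) = contradiction (trans (sym (φ-colour (ι a) (ι a)))
      (trans (cong₂ col″ (sym new≡) (sym new≡)) (trans (col″-join (inj₁ i) (inj₁ i)) (x∈X i)))) (ι-avoid a)

  opaque
    ψ : Fin m → Fin m′
    ψ a = proj₁ (old-point a)

    ψ-old : ∀ a → 2 ↑ʳ ψ a ≡ Bijection.to φ (ι a)
    ψ-old a = proj₂ (old-point a)

  ψ-colour : ∀ a₁ b₁ → d′ (ψ a₁) (ψ b₁) ≡ B.to (d a₁ b₁)
  ψ-colour a₁ b₁ = trans (sym (B.to-from (d′ (ψ a₁) (ψ b₁)))) (cong B.to (g-inj _ _ g-from≡))
    where
    g-from≡ : g (B.from (d′ (ψ a₁) (ψ b₁))) ≡ g (d a₁ b₁)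
    g-from≡ = trans (sym (col″-join (inj₂ (ψ a₁)) (inj₂ (ψ b₁))))
      (trans (cong₂ col″ (ψ-old a₁) (ψ-old b₁)) (trans (φ-colour (ι a₁) (ι b₁)) (g-col a₁ b₁)))

  ψ-injective : Injective _≡_ _≡_ ψ
  ψ-injective {a₁} {b₁} ψa≡ψb =
    ι-inj a₁ b₁ (Bijection.injective φ (trans (sym (ψ-old a₁)) (trans (cong (2 ↑ʳ_) ψa≡ψb) (ψ-old b₁))))

  ψ-surjective : ∀ w′ → ∃ λ a₁ → ψ a₁ ≡ w′
  ψ-surjective w′ = proj₁ (ι-range z ¬Xz) ,
    ↑ʳ-injective 2 _ _ (trans (ψ-old _) (trans (cong (Bijection.to φ) (proj₂ (ι-range z ¬Xz))) φz≡))
    where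
    z : Fin n
    z = proj₁ (Bijection.surjective φ (2 ↑ʳ w′))
    φz≡ : Bijection.to φ z ≡ 2 ↑ʳ w′
    φz≡ = proj₂ (Bijection.surjective φ (2 ↑ʳ w′)) refl
    ¬Xz : ¬ X z
    ¬Xz = colour-avoids (trans (sym (φ-colour z z)) (trans (cong₂ col″ φz≡ φz≡) (col″-join (inj₂ w′) (inj₂ w′))))

  induced : Induced b
  induced = mk⤖′ ψ ψ-injective ψ-surjective , ψ-colour

lemma5p1 : ∀ {n r} (C : CC n r) → n > 2 → Indecomposable C →
    (∀ x → fiberSize C x ≡ 4 ⊎ fiberSize C x ≡ 2) →
    NoMatchingInterspace C →
    (x₀ : Fin n) → fiberSize C x₀ ≡ 2 →
    ∀ {m s} (D : CC m s) → IsRemoval C x₀ D →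
    Separable C ⇔ Separable D
lemma5p1 C n>2 indecomposable _ _ x₀ |X|≡2 D removal = mk⇔
  (λ C-separable _ _ _ b → RestrictToRemoval.induced C n>2 indecomposable x₀ |X|≡2 removal C-separable b)
  (λ D-separable _ _ _ a → ExtendFromRemoval.induced C n>2 indecomposable x₀ |X|≡2 removal D-separable a)
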